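{- In type $C_n^{(1)}$, for every $0\le j\le n$ and $1\le i\le n$, $\mathcal L_{\Lambda_j}(t_{\omega_i})=2n\,\mathrm{ch}_j(\omega_i)-i\frac{n-i}{2}$; in particular $\mathcal L_{\Lambda_0}(t_{\omega_n})=0$. Moreover $\mathcal L_{\Lambda_i}(t_{\omega_i})=ni-i\frac{n-i}{2}$ for $1\le i<n$, and $\mathcal L_{\Lambda_n}(t_{\omega_n})=n^2$.
   Context: Fix $n\ge2$. $V_0=\mathbb R^n$ with standard inner product, $\alpha_i=\frac1{\sqrt2}(\varepsilon_i-\varepsilon_{i+1})$ ($1\le i\le n-1$), $\alpha_n=\sqrt2\varepsilon_n$, $\theta=2\alpha_1+\dots+2\alpha_{n-1}+\alpha_n$; $a_0=a_n=1$, $a_j=2$ ($1\le j\le n-1$), $a_j^\vee=1$ for all $j$. $\mathfrak h^*=V_0\oplus\mathbb R\delta\oplus\mathbb R\Lambda_0$, $\alpha_0=\delta-\theta$; $\mathrm{ht}$ is linear on $V_0\oplus\mathbb R\delta$ with $\mathrm{ht}(\alpha_i)=1$ ($0\le i\le n$), so $\mathrm{ht}(\delta)=2n$. $\langle\cdot,c\rangle$ vanishes on $V_0\oplus\mathbb R\delta$ with $\langle\Lambda_0,c\rangle=1$; $(\delta|x)=(\Lambda_0|x)=0$ for $x\in V_0$. For $x\in V_0$, $t_x(v)=v+\langle v,c\rangle x-\big((v|x)+\tfrac12|x|^2\langle v,c\rangle\big)\delta$. $\omega_i=\frac{\sqrt2}{2}(\varepsilon_1+\dots+\varepsilon_i)$,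 $\omega_0=0$, $\Lambda_j=\Lambda_0+\omega_j$. $\mathcal L_\Lambda(g)=\mathrm{ht}(\Lambda-g\Lambda)$. For $x=\sum_{k=1}^n x_k\alpha_k$, $\mathrm{ch}_j(x)=x_j\,a_j^\vee/a_j$ for $1\le j\le n$ and $\mathrm{ch}_0(x)=0$. -}

module Defs where

open import Data.Nat using (ℕ; zero; suc; _<ᵇ_; _≡ᵇ_)
open import Data.Fin using (Fin; toℕ)
open import Data.Bool using (Bool; true; false; if_then_else_)
open import Data.Integer using (+_)
open import Data.Rational using (ℚ; _+_; _*_; _-_; -_; 0ℚ; 1ℚ; ½; _/_)

ℕ→ℚ : ℕ → ℚ
ℕ→ℚ m = + m / 1

Σ[_] : ∀ {n} → (Fin n → ℚ) → ℚ
Σ[_] {zero}  f = 0ℚ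
Σ[_] {suc n} f = f Fin.zero + Σ[_] (λ k → f (Fin.suc k))

-- Encoding: u : Fin n → ℚ represents the vector (1/√2)·Σ_k u(k) ε_{k+1}.
-- All vectors of the statement (αᵢ, ωᵢ, θ) lie in this ℚ-subspace (1/√2)ℚⁿ,
-- which is closed under + and ℚ-scaling, and its inner product is rational.
V₀ : ℕ → Set
V₀ n = Fin n → ℚ

_+ᵥ_ : ∀ {n} → V₀ n → V₀ n → V₀ n
(u +ᵥ v) k = u k + v k

_·ᵥ_ : ∀ {n} → ℚ → V₀ n → V₀ n
(c ·ᵥ v) k = c * v k

-- standard inner product: ((1/√2)u | (1/√2)v) = (u·v)/2
⟨_∣_⟩ : ∀ {n} → V₀ n → V₀ n → ℚ
⟨ u ∣ v ⟩ = ½ * Σ[ (λ k → u k * v k) ]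

∣_∣² : ∀ {n} → V₀ n → ℚ
∣ x ∣² = ⟨ x ∣ x ⟩

ind : Bool → ℚ
ind b = if b then 1ℚ else 0ℚ

-- simple roots (i is the 1-based index 1 ≤ i ≤ n):
-- αᵢ = (1/√2)(εᵢ − ε_{i+1}) (i<n),  αₙ = √2 εₙ = (1/√2)(2εₙ)
α : (n i : ℕ) → V₀ n
α n i k = if i <ᵇ n
          then ind (suc (toℕ k) ≡ᵇ i) - ind (suc (toℕ k) ≡ᵇ suc i)
          else ℕ→ℚ 2 * ind (suc (toℕ k) ≡ᵇ n)

-- fundamental coweights-as-weights ωᵢ = (√2/2)(ε₁+…+εᵢ) = (1/√2)(ε₁+…+εᵢ), ω₀ = 0
ω : (n i : ℕ) → V₀ n
ω n i k = ind (toℕ k <ᵇ i)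

-- coordinates in the basis α₁,…,αₙ:  x = Σₘ coordₘ(x) αₘ.
-- Inverting u = Σ_{m<n} xₘ (e_m − e_{m+1}) + 2 xₙ eₙ gives
--   xₘ = u₁+…+uₘ  (1 ≤ m < n),   xₙ = (u₁+…+uₙ)/2.
coord : (n m : ℕ) → V₀ n → ℚ
coord n m u = if m <ᵇ n
              then Σ[ (λ k → ind (toℕ k <ᵇ m) * u k) ]
              else ½ * Σ[ u ]

-- ht on V₀ : linear with ht(αᵢ) = 1, i.e. sum of α-coordinates
htV : (n : ℕ) → V₀ n → ℚ
htV n u = Σ[ (λ (m : Fin n) → coord n (suc (toℕ m)) u) ]

-- 𝔥* = V₀ ⊕ ℝδ ⊕ ℝΛ₀ ; an element v + dδ + lΛ₀
record 𝔥* (n : ℕ) : Set where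
  constructor ⟨_,_,_⟩
  field
    vpart : V₀ n
    δpart : ℚ
    Λ₀part : ℚ
open 𝔥* public

_-ₕ_ : ∀ {n} → 𝔥* n → 𝔥* n → 𝔥* n
⟨ v , d , l ⟩ -ₕ ⟨ v' , d' , l' ⟩ = ⟨ (λ k → v k - v' k) , d - d' , l - l' ⟩

⟨_,c⟩ : ∀ {n} → 𝔥* n → ℚ
⟨ λ' ,c⟩ = Λ₀part λ'

ht : (n : ℕ) → 𝔥* n → ℚ
ht n λ' = htV n (vpart λ') + ℕ→ℚ (2 Data.Nat.* n) * δpart λ'

-- translation t_x(v) = v + ⟨v,c⟩x − ((v|x) + ½|x|²⟨v,c⟩)δ
-- ((δ|x) = (Λ₀|x) = 0, so (v|x) only involves the V₀-part)
t : ∀ {n} → V₀ n → 𝔥* n → 𝔥* n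
t x λ' = ⟨ vpart λ' +ᵥ (⟨ λ' ,c⟩ ·ᵥ x)
         , δpart λ' - (⟨ vpart λ' ∣ x ⟩ + ½ * ∣ x ∣² * ⟨ λ' ,c⟩)
         , Λ₀part λ' ⟩

Λ₀ : (n : ℕ) → 𝔥* n
Λ₀ n = ⟨ (λ _ → 0ℚ) , 0ℚ , 1ℚ ⟩

Λ : (n j : ℕ) → 𝔥* n
Λ n j = ⟨ ω n j , 0ℚ , 1ℚ ⟩

𝓛 : (n : ℕ) → 𝔥* n → (𝔥* n → 𝔥* n) → ℚ
𝓛 n λ' g = ht n (λ' -ₕ g λ')

a : (n j : ℕ) → ℕ
a n zero = 1
a n (suc j) = if suc j <ᵇ n then 2 else 1

a-nonzero : ∀ n j → Data.Nat.NonZero (a n j)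
a-nonzero n zero = _
a-nonzero n (suc j) with suc j <ᵇ n
... | true = _
... | false = _

a∨ : (n j : ℕ) → ℕ
a∨ n j = 1

ch : (n j : ℕ) → V₀ n → ℚ
ch n zero x = 0ℚ
ch n (suc j) x = coord n (suc j) x * (+ (a∨ n (suc j)) / 1) * ((+ 1 / a n (suc j)) {{a-nonzero n (suc j)}})

-- On a level-one weight Λⱼ the translation acts by Λⱼ − t_{ωᵢ}Λⱼ = −ωᵢ + ((ωⱼ|ωᵢ) + ½|ωᵢ|²)δ,
-- so 𝓛 = 2n((ωⱼ|ωᵢ) + ½|ωᵢ|²) − ht(ωᵢ).  The α-coordinates of ωᵢ are min(m, i) for m < n and i/2
-- for m = n; hence chⱼ(ωᵢ) = (ωⱼ|ωᵢ) = ½ min(i, j), |ωᵢ|² = i/2 and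
-- ht(ωᵢ) = Σ_{0<m<n} min(m, i) + i/2 = in − i²/2, which gives 2n chⱼ(ωᵢ) − i(n − i)/2.
module Submission where

open import Defs
open import Algebra.Bundles using (CommutativeMonoid)
open import Data.Bool using (true; false)
open import Data.Bool.Properties using (T-≡)
open import Data.Fin as Fin using (Fin; toℕ; inject₁; fromℕ)
open import Data.Fin.Properties using (toℕ-inject₁; toℕ-fromℕ; toℕ<n)
import Data.Integer as ℤ
import Data.Integer.Properties as ℤₚ
open import Data.Nat using (ℕ; zero; suc; _≤_; _<_; _∸_; _⊓_; _<ᵇ_; z≤n; s≤s)
import Data.Nat as ℕ
import Data.Nat.Properties as ℕₚ
open import Data.Nat.Tactic.RingSolver using (solve-∀)
open import Data.Product using (_×_; _,_)
open import Data.Rational using (ℚ; _+_; _*_; _-_; -_; ½; 0ℚ; 1ℚ; toℚᵘ)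
open import Data.Rational.Properties
  using ( toℚᵘ-injective; toℚᵘ-fromℚᵘ; toℚᵘ-homo-+; toℚᵘ-homo-*
        ; +-comm; +-assoc; +-identityʳ; *-zeroˡ; *-zeroʳ; *-distribˡ-+; *-1-commutativeMonoid )
open import Data.Rational.Solver using (module +-*-Solver)
import Data.Rational.Unnormalised as ℚᵘ
import Data.Rational.Unnormalised.Properties as ℚᵘₚ
open import Data.Sum using (inj₁; inj₂)
open import Function using (_∘_)
open import Function.Bundles using (Equivalence)
open import Relation.Binary.PropositionalEquality

open import Algebra.Properties.CommutativeSemigroup
  (CommutativeMonoid.commutativeSemigroup *-1-commutativeMonoid) using (x∙yz≈y∙xz)

ℕ→ℚᵘ : ℕ → ℚᵘ.ℚᵘ
ℕ→ℚᵘ m = ℚᵘ.mkℚᵘ (ℤ.+ m) 0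

ℕ→ℚ-homo-+ : ∀ m n → ℕ→ℚ (m ℕ.+ n) ≡ ℕ→ℚ m + ℕ→ℚ n
ℕ→ℚ-homo-+ m n = toℚᵘ-injective (begin-equality
  toℚᵘ (ℕ→ℚ (m ℕ.+ n))            ≃⟨ toℚᵘ-fromℚᵘ (ℕ→ℚᵘ (m ℕ.+ n)) ⟩
  ℕ→ℚᵘ (m ℕ.+ n)                  ≃⟨ ℚᵘ.*≡* (cong (ℤ._* ℤ.+ 1) (sym (cong₂ ℤ._+_ (ℤₚ.*-identityʳ (ℤ.+ m)) (ℤₚ.*-identityʳ (ℤ.+ n))))) ⟩
  ℕ→ℚᵘ m ℚᵘ.+ ℕ→ℚᵘ n              ≃⟨ ℚᵘₚ.+-cong (toℚᵘ-fromℚᵘ (ℕ→ℚᵘ m)) (toℚᵘ-fromℚᵘ (ℕ→ℚᵘ n)) ⟨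
  toℚᵘ (ℕ→ℚ m) ℚᵘ.+ toℚᵘ (ℕ→ℚ n)  ≃⟨ toℚᵘ-homo-+ (ℕ→ℚ m) (ℕ→ℚ n) ⟨
  toℚᵘ (ℕ→ℚ m + ℕ→ℚ n)            ∎)
  where open ℚᵘₚ.≤-Reasoning

ℕ→ℚ-homo-* : ∀ m n → ℕ→ℚ (m ℕ.* n) ≡ ℕ→ℚ m * ℕ→ℚ n
ℕ→ℚ-homo-* m n = toℚᵘ-injective (begin-equality
  toℚᵘ (ℕ→ℚ (m ℕ.* n))            ≃⟨ toℚᵘ-fromℚᵘ (ℕ→ℚᵘ (m ℕ.* n)) ⟩
  ℕ→ℚᵘ (m ℕ.* n)                  ≃⟨ ℚᵘ.*≡* (cong (ℤ._* ℤ.+ 1) (ℤₚ.pos-* m n)) ⟩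
  ℕ→ℚᵘ m ℚᵘ.* ℕ→ℚᵘ n              ≃⟨ ℚᵘₚ.*-cong (toℚᵘ-fromℚᵘ (ℕ→ℚᵘ m)) (toℚᵘ-fromℚᵘ (ℕ→ℚᵘ n)) ⟨
  toℚᵘ (ℕ→ℚ m) ℚᵘ.* toℚᵘ (ℕ→ℚ n)  ≃⟨ toℚᵘ-homo-* (ℕ→ℚ m) (ℕ→ℚ n) ⟨
  toℚᵘ (ℕ→ℚ m * ℕ→ℚ n)            ∎)
  where open ℚᵘₚ.≤-Reasoning

open ≡-Reasoning

<ᵇ-true : ∀ {m n} → m < n → (m <ᵇ n) ≡ true
<ᵇ-true m<n = Equivalence.to T-≡ (ℕₚ.<⇒<ᵇ m<n)

<ᵇ-irrefl : ∀ n → (n <ᵇ n) ≡ false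
<ᵇ-irrefl zero    = refl
<ᵇ-irrefl (suc n) = <ᵇ-irrefl n

Σ-cong : ∀ {n} {f g : Fin n → ℚ} → (∀ k → f k ≡ g k) → Σ[ f ] ≡ Σ[ g ]
Σ-cong {zero}  f≗g = refl
Σ-cong {suc n} f≗g = cong₂ _+_ (f≗g Fin.zero) (Σ-cong (f≗g ∘ Fin.suc))

Σ-*ˡ : ∀ {n} c (f : Fin n → ℚ) → Σ[ (λ k → c * f k) ] ≡ c * Σ[ f ]
Σ-*ˡ {zero}  c f = sym (*-zeroʳ c)
Σ-*ˡ {suc n} c f =
  trans (cong (c * f Fin.zero +_) (Σ-*ˡ c (f ∘ Fin.suc))) (sym (*-distribˡ-+ c _ _))

Σ-last : ∀ {n} (f : Fin (suc n) → ℚ) → Σ[ f ] ≡ Σ[ f ∘ inject₁ ] + f (fromℕ n)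
Σ-last {zero}  f = +-comm (f Fin.zero) 0ℚ
Σ-last {suc n} f =
  trans (cong (f Fin.zero +_) (Σ-last (f ∘ Fin.suc))) (sym (+-assoc (f Fin.zero) _ _))

Σ-ind-< : ∀ n p → Σ[_] {n} (λ k → ind (toℕ k <ᵇ p)) ≡ ℕ→ℚ (p ⊓ n)
Σ-ind-< zero    p       rewrite ℕₚ.⊓-zeroʳ p = refl
Σ-ind-< (suc n) zero    = cong (0ℚ +_) (Σ-ind-< n zero)
Σ-ind-< (suc n) (suc p) = trans (cong (1ℚ +_) (Σ-ind-< n p)) (sym (ℕ→ℚ-homo-+ 1 (p ⊓ n)))

ind-<-⊓ : ∀ x a b → ind (x <ᵇ a) * ind (x <ᵇ b) ≡ ind (x <ᵇ a ⊓ b)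
ind-<-⊓ x       zero    b       = *-zeroˡ (ind (x <ᵇ b))
ind-<-⊓ x       (suc a) zero    = *-zeroʳ (ind (x <ᵇ suc a))
ind-<-⊓ zero    (suc a) (suc b) = refl
ind-<-⊓ (suc x) (suc a) (suc b) = ind-<-⊓ x a b

coord-cong : ∀ n m {u v : V₀ n} → (∀ k → u k ≡ v k) → coord n m u ≡ coord n m v
coord-cong n m u≗v with m <ᵇ n
... | true  = Σ-cong (λ k → cong (ind (toℕ k <ᵇ m) *_) (u≗v k))
... | false = cong (½ *_) (Σ-cong u≗v)

coord-*ˡ : ∀ n m c (u : V₀ n) → coord n m (c ·ᵥ u) ≡ c * coord n m u
coord-*ˡ n m c u with m <ᵇ n
... | true  = trans (Σ-cong {n} (λ k → x∙yz≈y∙xz (ind (toℕ k <ᵇ m)) c (u k)))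
                    (Σ-*ˡ {n} c _)
... | false = trans (cong (½ *_) (Σ-*ˡ c u)) (x∙yz≈y∙xz ½ c Σ[ u ])

htV-cong : ∀ n {u v : V₀ n} → (∀ k → u k ≡ v k) → htV n u ≡ htV n v
htV-cong n u≗v = Σ-cong {n} (λ m → coord-cong n (suc (toℕ m)) u≗v)

htV-*ˡ : ∀ n c (u : V₀ n) → htV n (c ·ᵥ u) ≡ c * htV n u
htV-*ˡ n c u = trans (Σ-cong {n} (λ m → coord-*ˡ n (suc (toℕ m)) c u)) (Σ-*ˡ {n} c _)

𝓛-t : ∀ n (μ : 𝔥* n) x →
  𝓛 n μ (t x) ≡ ℕ→ℚ (2 ℕ.* n) * (⟨ vpart μ ∣ x ⟩ + ½ * ∣ x ∣² * ⟨ μ ,c⟩) - ⟨ μ ,c⟩ * htV n x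
𝓛-t n μ x = begin
  htV n (λ k → v k - (v k + l * x k)) + T * (d - (d - P))
    ≡⟨ cong₂ _+_ (trans (htV-cong n (λ k → cancel-v (v k) l (x k))) (htV-*ˡ n (- l) x))
                 (cong (T *_) (cancel-δ d P)) ⟩
  (- l) * htV n x + T * P
    ≡⟨ reorder l (htV n x) T P ⟩
  T * P - l * htV n x ∎
  where
  open +-*-Solver
  v = vpart μ
  d = δpart μ
  l = ⟨ μ ,c⟩
  T = ℕ→ℚ (2 ℕ.* n)
  P = ⟨ v ∣ x ⟩ + ½ * ∣ x ∣² * l
  cancel-v : ∀ a b c → a - (a + b * c) ≡ (- b) * c
  cancel-v = solve 3 (λ a b c → a :- (a :+ b :* c) := (:- b) :* c) refl
  cancel-δ : ∀ a b → a - (a - b) ≡ b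
  cancel-δ = solve 2 (λ a b → a :- (a :- b) := b) refl
  reorder : ∀ a h s p → (- a) * h + s * p ≡ s * p - a * h
  reorder = solve 4 (λ a h s p → (:- a) :* h :+ s :* p := s :* p :- a :* h) refl

Σ-ω*ω : ∀ n a b → Σ[ (λ k → ω n a k * ω n b k) ] ≡ ℕ→ℚ (a ⊓ b ⊓ n)
Σ-ω*ω n a b = trans (Σ-cong {n} (λ k → ind-<-⊓ (toℕ k) a b)) (Σ-ind-< n (a ⊓ b))

⟨ω∣ω⟩ : ∀ {n a} b → a ≤ n → ⟨ ω n a ∣ ω n b ⟩ ≡ ½ * ℕ→ℚ (a ⊓ b)
⟨ω∣ω⟩ {n} {a} b a≤n =
  cong (½ *_) (trans (Σ-ω*ω n a b) (cong ℕ→ℚ (ℕₚ.m≤n⇒m⊓n≡m (ℕₚ.m≤n⇒m⊓o≤n b a≤n))))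

coord-ω : ∀ {n m} i → m < n → coord n m (ω n i) ≡ ℕ→ℚ (m ⊓ i)
coord-ω {n} {m} i m<n rewrite <ᵇ-true m<n =
  trans (Σ-ω*ω n m i) (cong ℕ→ℚ (ℕₚ.m≤n⇒m⊓n≡m (ℕₚ.≤-trans (ℕₚ.m⊓n≤m m i) (ℕₚ.<⇒≤ m<n))))

coord-ω-last : ∀ {n} i → i ≤ n → coord n n (ω n i) ≡ ½ * ℕ→ℚ i
coord-ω-last {n} i i≤n rewrite <ᵇ-irrefl n =
  cong (½ *_) (trans (Σ-ind-< n i) (cong ℕ→ℚ (ℕₚ.m≤n⇒m⊓n≡m i≤n)))

ch-< : ∀ {n j} x → suc j < n → ch n (suc j) x ≡ coord n (suc j) x * 1ℚ * ½
ch-< {n} {j} x j<n with suc j <ᵇ n | <ᵇ-true j<n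
... | true | refl = refl

ch-last : ∀ {n} x → ch (suc n) (suc n) x ≡ coord (suc n) (suc n) x * 1ℚ * 1ℚ
ch-last {n} x with n <ᵇ n | <ᵇ-irrefl n
... | false | refl = refl

ch-ω : ∀ {n j} i → j ≤ n → i ≤ n → ch n j (ω n i) ≡ ½ * ℕ→ℚ (j ⊓ i)
ch-ω {j = zero} i _ _ = refl
ch-ω {n} {suc j} i j≤n i≤n with ℕₚ.m≤n⇒m<n∨m≡n j≤n
... | inj₁ j<n = begin
  ch n (suc j) (ω n i)                ≡⟨ ch-< (ω n i) j<n ⟩
  coord n (suc j) (ω n i) * 1ℚ * ½    ≡⟨ cong (λ c → c * 1ℚ * ½) (coord-ω i j<n) ⟩
  ℕ→ℚ (suc j ⊓ i) * 1ℚ * ½           ≡⟨ solve 1 (λ c → c :* con 1ℚ :* con ½ := con ½ :* c) refl (ℕ→ℚ (suc j ⊓ i)) ⟩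
  ½ * ℕ→ℚ (suc j ⊓ i)                 ∎
  where open +-*-Solver
... | inj₂ refl = begin
  ch n n (ω n i)                ≡⟨ ch-last (ω n i) ⟩
  coord n n (ω n i) * 1ℚ * 1ℚ   ≡⟨ cong (λ c → c * 1ℚ * 1ℚ) (coord-ω-last i i≤n) ⟩
  ½ * ℕ→ℚ i * 1ℚ * 1ℚ           ≡⟨ solve 1 (λ c → c :* con 1ℚ :* con 1ℚ := c) refl (½ * ℕ→ℚ i) ⟩
  ½ * ℕ→ℚ i                     ≡⟨ cong (λ m → ½ * ℕ→ℚ m) (ℕₚ.m≥n⇒m⊓n≡n i≤n) ⟨
  ½ * ℕ→ℚ (n ⊓ i)               ∎
  where open +-*-Solver

minSum : ℕ → ℕ → ℕ
minSum zero    i = 0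
minSum (suc N) i = minSum N i ℕ.+ suc N ⊓ i

Σ-minSum : ∀ N i → Σ[_] {N} (λ k → ℕ→ℚ (suc (toℕ k) ⊓ i)) ≡ ℕ→ℚ (minSum N i)
Σ-minSum zero    i = refl
Σ-minSum (suc N) i = begin
  Σ[_] {suc N} (term ∘ toℕ)
    ≡⟨ Σ-last {N} (term ∘ toℕ) ⟩
  Σ[_] {N} (term ∘ toℕ ∘ inject₁) + term (toℕ (fromℕ N))
    ≡⟨ cong₂ _+_ (Σ-cong {N} (cong term ∘ toℕ-inject₁)) (cong term (toℕ-fromℕ N)) ⟩
  Σ[_] {N} (term ∘ toℕ) + term N
    ≡⟨ cong (_+ term N) (Σ-minSum N i) ⟩
  ℕ→ℚ (minSum N i) + term N
    ≡⟨ ℕ→ℚ-homo-+ (minSum N i) (suc N ⊓ i) ⟨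
  ℕ→ℚ (minSum (suc N) i) ∎
  where
  term : ℕ → ℚ
  term m = ℕ→ℚ (suc m ⊓ i)

minSum-saturated : ∀ N i → N ≤ i → 2 ℕ.* minSum N i ≡ N ℕ.* suc N
minSum-saturated zero    i N≤i = refl
minSum-saturated (suc N) i N<i = begin
  2 ℕ.* (minSum N i ℕ.+ suc N ⊓ i) ≡⟨ cong (λ m → 2 ℕ.* (minSum N i ℕ.+ m)) (ℕₚ.m≤n⇒m⊓n≡m N<i) ⟩
  2 ℕ.* (minSum N i ℕ.+ suc N)     ≡⟨ ℕₚ.*-distribˡ-+ 2 (minSum N i) (suc N) ⟩
  2 ℕ.* minSum N i ℕ.+ 2 ℕ.* suc N ≡⟨ cong (ℕ._+ 2 ℕ.* suc N) (minSum-saturated N i (ℕₚ.<⇒≤ N<i)) ⟩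
  N ℕ.* suc N ℕ.+ 2 ℕ.* suc N      ≡⟨ triangle N ⟩
  suc N ℕ.* suc (suc N)            ∎
  where
  triangle : ∀ n → n ℕ.* suc n ℕ.+ 2 ℕ.* suc n ≡ suc n ℕ.* suc (suc n)
  triangle = solve-∀

minSum-formula : ∀ N i → i ≤ suc N → 2 ℕ.* minSum N i ℕ.+ i ℕ.+ i ℕ.* i ≡ 2 ℕ.* i ℕ.* suc N
minSum-formula N i i≤1+N with ℕₚ.m≤n⇒m<n∨m≡n i≤1+N
minSum-formula N .(suc N) _ | inj₂ refl = begin
  2 ℕ.* minSum N (suc N) ℕ.+ suc N ℕ.+ suc N ℕ.* suc N
    ≡⟨ cong (λ s → s ℕ.+ suc N ℕ.+ suc N ℕ.* suc N) (minSum-saturated N (suc N) (ℕₚ.n≤1+n N)) ⟩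
  N ℕ.* suc N ℕ.+ suc N ℕ.+ suc N ℕ.* suc N
    ≡⟨ triangle N ⟩
  2 ℕ.* suc N ℕ.* suc N ∎
  where
  triangle : ∀ n → n ℕ.* suc n ℕ.+ suc n ℕ.+ suc n ℕ.* suc n ≡ 2 ℕ.* suc n ℕ.* suc n
  triangle = solve-∀
minSum-formula zero    zero    _ | inj₁ _ = refl
minSum-formula zero    (suc _) _ | inj₁ (s≤s ())
minSum-formula (suc N) i       _ | inj₁ (s≤s i≤1+N) = begin
  2 ℕ.* (minSum N i ℕ.+ suc N ⊓ i) ℕ.+ i ℕ.+ i ℕ.* i
    ≡⟨ cong (λ m → 2 ℕ.* (minSum N i ℕ.+ m) ℕ.+ i ℕ.+ i ℕ.* i) (ℕₚ.m≥n⇒m⊓n≡n i≤1+N) ⟩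
  2 ℕ.* (minSum N i ℕ.+ i) ℕ.+ i ℕ.+ i ℕ.* i
    ≡⟨ regroup (minSum N i) i ⟩
  (2 ℕ.* minSum N i ℕ.+ i ℕ.+ i ℕ.* i) ℕ.+ 2 ℕ.* i
    ≡⟨ cong (ℕ._+ 2 ℕ.* i) (minSum-formula N i i≤1+N) ⟩
  2 ℕ.* i ℕ.* suc N ℕ.+ 2 ℕ.* i
    ≡⟨ ℕₚ.+-comm (2 ℕ.* i ℕ.* suc N) (2 ℕ.* i) ⟩
  2 ℕ.* i ℕ.+ 2 ℕ.* i ℕ.* suc N
    ≡⟨ ℕₚ.*-suc (2 ℕ.* i) (suc N) ⟨
  2 ℕ.* i ℕ.* suc (suc N) ∎
  where
  regroup : ∀ s i → 2 ℕ.* (s ℕ.+ i) ℕ.+ i ℕ.+ i ℕ.* i ≡ (2 ℕ.* s ℕ.+ i ℕ.+ i ℕ.* i) ℕ.+ 2 ℕ.* i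
  regroup = solve-∀

htV-ω : ∀ n i → i ≤ n → htV n (ω n i) ≡ ℕ→ℚ i * ℕ→ℚ n - ½ * (ℕ→ℚ i * ℕ→ℚ i)
htV-ω zero    zero z≤n = refl
htV-ω (suc N) i    i≤n = begin
  htV n (ω n i)
    ≡⟨ Σ-last {N} (coord-ωᵢ ∘ suc ∘ toℕ) ⟩
  Σ[_] {N} (coord-ωᵢ ∘ suc ∘ toℕ ∘ inject₁) + coord-ωᵢ (suc (toℕ (fromℕ N)))
    ≡⟨ cong₂ _+_ (Σ-cong {N} coord-ωᵢ-inner) coord-ωᵢ-last ⟩
  Σ[_] {N} (λ k → ℕ→ℚ (suc (toℕ k) ⊓ i)) + ½ * I
    ≡⟨ cong (_+ ½ * I) (Σ-minSum N i) ⟩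
  ℕ→ℚ (minSum N i) + ½ * I
    ≡⟨ halve (ℕ→ℚ (minSum N i)) I (ℕ→ℚ n) formula ⟩
  I * ℕ→ℚ n - ½ * (I * I) ∎
  where
  n = suc N
  I = ℕ→ℚ i
  two = ℕ→ℚ 2

  coord-ωᵢ : ℕ → ℚ
  coord-ωᵢ m = coord n m (ω n i)

  coord-ωᵢ-inner : ∀ k → coord-ωᵢ (suc (toℕ (inject₁ k))) ≡ ℕ→ℚ (suc (toℕ k) ⊓ i)
  coord-ωᵢ-inner k = trans (cong (coord-ωᵢ ∘ suc) (toℕ-inject₁ k)) (coord-ω i (s≤s (toℕ<n k)))

  coord-ωᵢ-last : coord-ωᵢ (suc (toℕ (fromℕ N))) ≡ ½ * I
  coord-ωᵢ-last = trans (cong (coord-ωᵢ ∘ suc) (toℕ-fromℕ N)) (coord-ω-last i i≤n)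

  formula : two * ℕ→ℚ (minSum N i) + I + I * I ≡ two * I * ℕ→ℚ n
  formula = begin
    two * ℕ→ℚ (minSum N i) + I + I * I
      ≡⟨ cong (λ x → x + I + I * I) (ℕ→ℚ-homo-* 2 (minSum N i)) ⟨
    ℕ→ℚ (2 ℕ.* minSum N i) + I + I * I
      ≡⟨ cong₂ _+_ (ℕ→ℚ-homo-+ (2 ℕ.* minSum N i) i) (ℕ→ℚ-homo-* i i) ⟨
    ℕ→ℚ (2 ℕ.* minSum N i ℕ.+ i) + ℕ→ℚ (i ℕ.* i)
      ≡⟨ ℕ→ℚ-homo-+ (2 ℕ.* minSum N i ℕ.+ i) (i ℕ.* i) ⟨
    ℕ→ℚ (2 ℕ.* minSum N i ℕ.+ i ℕ.+ i ℕ.* i)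
      ≡⟨ cong ℕ→ℚ (minSum-formula N i i≤n) ⟩
    ℕ→ℚ (2 ℕ.* i ℕ.* n)
      ≡⟨ trans (ℕ→ℚ-homo-* (2 ℕ.* i) n) (cong (_* ℕ→ℚ n) (ℕ→ℚ-homo-* 2 i)) ⟩
    two * I * ℕ→ℚ n ∎

  halve : ∀ s x m → two * s + x + x * x ≡ two * x * m → s + ½ * x ≡ x * m - ½ * (x * x)
  halve s x m hyp = begin
    s + ½ * x
      ≡⟨ solve 2 (λ s x → s :+ con ½ :* x
                   := con ½ :* (con two :* s :+ x :+ x :* x) :- con ½ :* (x :* x)) refl s x ⟩
    ½ * (two * s + x + x * x) - ½ * (x * x)
      ≡⟨ cong (λ z → ½ * z - ½ * (x * x)) hyp ⟩
    ½ * (two * x * m) - ½ * (x * x)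
      ≡⟨ solve 2 (λ x m → con ½ :* (con two :* x :* m) :- con ½ :* (x :* x)
                   := x :* m :- con ½ :* (x :* x)) refl x m ⟩
    x * m - ½ * (x * x) ∎
    where open +-*-Solver

𝓛-Λ-t-ω : ∀ n j i → j ≤ n → i ≤ n →
  𝓛 n (Λ n j) (t (ω n i)) ≡ ℕ→ℚ (2 ℕ.* n) * ch n j (ω n i) - ℕ→ℚ i * (ℕ→ℚ (n ∸ i) * ½)
𝓛-Λ-t-ω n j i j≤n i≤n = begin
  𝓛 n (Λ n j) (t (ω n i))
    ≡⟨ 𝓛-t n (Λ n j) (ω n i) ⟩
  T * (⟨ ω n j ∣ ω n i ⟩ + ½ * ∣ ω n i ∣² * 1ℚ) - 1ℚ * htV n (ω n i)
    ≡⟨ cong₂ (λ p h → T * (p + ½ * ∣ ω n i ∣² * 1ℚ) - 1ℚ * h) ⟨ωⱼ∣ωᵢ⟩≡ch (htV-ω n i i≤n) ⟩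
  T * (C + ½ * ∣ ω n i ∣² * 1ℚ) - 1ℚ * (I * N - ½ * (I * I))
    ≡⟨ cong (λ q → T * (C + ½ * q * 1ℚ) - 1ℚ * (I * N - ½ * (I * I))) ∣ωᵢ∣² ⟩
  T * (C + ½ * (½ * I) * 1ℚ) - 1ℚ * (I * N - ½ * (I * I))
    ≡⟨ rearrange I D C (ℕ→ℚ-homo-* 2 n) D+I≡N ⟩
  T * C - I * (D * ½) ∎
  where
  T = ℕ→ℚ (2 ℕ.* n)
  N = ℕ→ℚ n
  I = ℕ→ℚ i
  D = ℕ→ℚ (n ∸ i)
  C = ch n j (ω n i)

  ⟨ωⱼ∣ωᵢ⟩≡ch : ⟨ ω n j ∣ ω n i ⟩ ≡ C
  ⟨ωⱼ∣ωᵢ⟩≡ch = trans (⟨ω∣ω⟩ i j≤n) (sym (ch-ω i j≤n i≤n))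

  ∣ωᵢ∣² : ∣ ω n i ∣² ≡ ½ * I
  ∣ωᵢ∣² = trans (⟨ω∣ω⟩ i i≤n) (cong (λ m → ½ * ℕ→ℚ m) (ℕₚ.⊓-idem i))

  D+I≡N : D + I ≡ N
  D+I≡N = trans (sym (ℕ→ℚ-homo-+ (n ∸ i) i)) (cong ℕ→ℚ (ℕₚ.m∸n+n≡m i≤n))

  rearrange : ∀ {t m} x d c → t ≡ ℕ→ℚ 2 * m → d + x ≡ m →
    t * (c + ½ * (½ * x) * 1ℚ) - 1ℚ * (x * m - ½ * (x * x)) ≡ t * c - x * (d * ½)
  rearrange x d c refl refl = solve 3 (λ x d c →
      con (ℕ→ℚ 2) :* (d :+ x) :* (c :+ con ½ :* (con ½ :* x) :* con 1ℚ)
        :- con 1ℚ :* (x :* (d :+ x) :- con ½ :* (x :* x))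
    := con (ℕ→ℚ 2) :* (d :+ x) :* c :- x :* (d :* con ½)) refl x d c
    where open +-*-Solver

2n*chᵢ[ωᵢ]≡n*i : ∀ {n i} → i ≤ n → ℕ→ℚ (2 ℕ.* n) * ch n i (ω n i) ≡ ℕ→ℚ (n ℕ.* i)
2n*chᵢ[ωᵢ]≡n*i {n} {i} i≤n = begin
  ℕ→ℚ (2 ℕ.* n) * ch n i (ω n i)      ≡⟨ cong₂ _*_ (ℕ→ℚ-homo-* 2 n) (ch-ω i i≤n i≤n) ⟩
  ℕ→ℚ 2 * ℕ→ℚ n * (½ * ℕ→ℚ (i ⊓ i))  ≡⟨ cong (λ m → ℕ→ℚ 2 * ℕ→ℚ n * (½ * ℕ→ℚ m)) (ℕₚ.⊓-idem i) ⟩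
  ℕ→ℚ 2 * ℕ→ℚ n * (½ * ℕ→ℚ i)        ≡⟨ solve 2 (λ n i → con (ℕ→ℚ 2) :* n :* (con ½ :* i) := n :* i) refl (ℕ→ℚ n) (ℕ→ℚ i) ⟩
  ℕ→ℚ n * ℕ→ℚ i                       ≡⟨ ℕ→ℚ-homo-* n i ⟨
  ℕ→ℚ (n ℕ.* i)                       ∎
  where open +-*-Solver

n*[n∸n]*½≡0 : ∀ n → ℕ→ℚ n * (ℕ→ℚ (n ∸ n) * ½) ≡ 0ℚ
n*[n∸n]*½≡0 n = trans (cong (λ d → ℕ→ℚ n * (ℕ→ℚ d * ½)) (ℕₚ.n∸n≡0 n)) (*-zeroʳ (ℕ→ℚ n))

proposition4p9 : (n : ℕ) → 2 ≤ n →
    ((j i : ℕ) → j ≤ n → 1 ≤ i → i ≤ n →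
      𝓛 n (Λ n j) (t (ω n i))
        ≡ ℕ→ℚ (2 Data.Nat.* n) * ch n j (ω n i) - ℕ→ℚ i * (ℕ→ℚ (n ∸ i) * ½))
  × (𝓛 n (Λ n 0) (t (ω n n)) ≡ 0ℚ)
  × ((i : ℕ) → 1 ≤ i → i < n →
      𝓛 n (Λ n i) (t (ω n i)) ≡ ℕ→ℚ (n Data.Nat.* i) - ℕ→ℚ i * (ℕ→ℚ (n ∸ i) * ½))
  × (𝓛 n (Λ n n) (t (ω n n)) ≡ ℕ→ℚ (n Data.Nat.* n))
proposition4p9 n _ =
    (λ j i j≤n _ i≤n → 𝓛-Λ-t-ω n j i j≤n i≤n)
  , trans (𝓛-Λ-t-ω n 0 n z≤n ℕₚ.≤-refl)
          (cong₂ _-_ (*-zeroʳ (ℕ→ℚ (2 ℕ.* n))) (n*[n∸n]*½≡0 n))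
  , (λ i _ i<n → trans (𝓛-Λ-t-ω n i i (ℕₚ.<⇒≤ i<n) (ℕₚ.<⇒≤ i<n))
                       (cong (_- ℕ→ℚ i * (ℕ→ℚ (n ∸ i) * ½)) (2n*chᵢ[ωᵢ]≡n*i (ℕₚ.<⇒≤ i<n))))
  , trans (𝓛-Λ-t-ω n n n ℕₚ.≤-refl ℕₚ.≤-refl)
          (trans (cong₂ _-_ (2n*chᵢ[ωᵢ]≡n*i {n} ℕₚ.≤-refl) (n*[n∸n]*½≡0 n)) (+-identityʳ (ℕ→ℚ (n ℕ.* n))))
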